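{- Let $\Gamma\vdash t:X$ be derivable in the source fragment $\textsc{core}$. Then the derivation of $\overline{\Gamma}\vdash \underline{t}:\overline{X}$ obtained from it by the CPS-translation can be annotated with labels (every abstraction and every application receives a label, with no two abstractions receiving the same label) such that it becomes a derivation, in the labelled calculus, of a well-labelled sequent $\overline{\Gamma}[\gamma^-,\gamma^+]\vdash \underline{t}:\overline{X}[x^-,x^+]$ for some $\gamma^-,\gamma^+,x^-,x^+\in\mathcal{L}^*$.
   Context: Source fragment $\textsc{core}$: types $X,Y ::= 1 \mid X\to Y$; terms $s,t ::= * \mid \lambda x{:}X.\,t \mid s\ t$; contexts are finite lists $x_1:X_1,\dots,x_n:X_n$; typing rules: (ax) $x:X\vdash x:X$; (1i) $\vdash *:1$; (weak) from $\Gamma\vdash t:Y$ infer $\Gamma,x:X\vdash t:Y$; (exch) from $\Gamma,y:Y,x:X,\Delta\vdash t:Z$ infer $\Gamma,x:X,y:Y,\Delta\vdash t:Z$; ($\to$i) from $\Gamma,x:X\vdash t:Y$ infer $\Gamma\vdash\lambda x{:}X.\,t:X\to Y$; ($\to$e) from $\Gamma\vdash s:X\to Y$ and $\Delta\vdash t:X$ infer $\Gamma,\Delta\vdash s\ t:Y$. CPS-translation target: the same language extended with a type $\bot$ (no rules), product types $X\times Y$ with pairs $<s,t>$ and $\mathtt{let}\ s\ \mathtt{be}\ <x,y>\ \mathtt{in}\ t$ (linear rules). $\neg X := X\to\bot$. Continuation types: $\underline{1}=\neg 1$, $\underline{X\to Y}=\neg\underline{X}\times\underline{Y}$; $\overline{X}:=\neg\underline{X}$;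 for $\Gamma=x_1:X_1,\dots$ write $\overline\Gamma=x_1:\overline{X_1},\dots$. The $\eta$-expansion $\eta(t,X)$ is: $t$ if $X$ is $1$ or $\bot$; $\mathtt{let}\ t\ \mathtt{be}\ <x,y>\ \mathtt{in}\ <\eta(x,X_1),\eta(y,X_2)>$ if $X=X_1\times X_2$; $\lambda x.\,\eta(t\ \eta(x,X_1),X_2)$ ($x$ fresh) if $X=X_1\to X_2$. The CPS-translation maps a derivation of $\Gamma\vdash t:X$ to a derivation of $\overline\Gamma\vdash\underline{t}:\overline X$ rule by rule: (ax) $x:\overline X\vdash\eta(x,\overline X):\overline X$; (1i) $\vdash\lambda k.\,k\ *:\overline 1$; (weak),(exch) same term with translated contexts; ($\to$i) from $\overline\Gamma,x:\overline X\vdash\underline t:\overline Y$ infer $\overline\Gamma\vdash\lambda<x,k>.\,\underline{t}\ k:\overline{X\to Y}$; ($\to$e) from $\overline\Gamma\vdash\underline s:\overline{X\to Y}$ and $\overline\Delta\vdash\underline t:\overline X$ infer $\overline\Gamma,\overline\Delta\vdash\lambda k.\,\underline s\ <\underline t,k>:\overline Y$. Here $\lambda<x,k>.\,u$ abbreviates $\lambda z.\,\mathtt{let}\ z\ \mathtt{be}\ <x,k>\ \mathtt{in}\ u$. Labelled calculus: fix an infinite set $\mathcal{L}$ of labels; abstractions are written $\lambda^l x.\,t$, applications $s\ @^l\ t$, function types $X\xrightarrow{l}Y$ ($l\in\mathcal{L}$), with $\neg_l X := X\xrightarrow{l}\bot$; typing: from $\Gamma,x:X\vdash t:Y$ infer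 $\Gamma\vdash\lambda^l x.\,t:X\xrightarrow{l}Y$; from $\Gamma\vdash s:X\xrightarrow{l}Y$ and $\Delta\vdash t:X$ infer $\Gamma,\Delta\vdash s\ @^l\ t:Y$; other rules as before. Terms must have no two abstractions with the same label. Interfaces (only lengths matter here): $1^-=1^+=\mathtt{unit}$ (lists of length 1), $(X\to Y)^-=Y^-X^+$, $(X\to Y)^+=Y^+X^-$ (concatenation). For $x^-,x^+\in\mathcal{L}^*$ with $|x^-|=|X^-|$, $|x^+|=|X^+|$, the labelled type $\overline X[x^-,x^+]$ is defined by: $\overline 1[q,a]=\neg_q\neg_a 1$; if $\overline Y[y^-,y^+]=\neg_q Y'$ then $\overline{X\to Y}[y^-x^+,y^+x^-]=\neg_q(\overline X[x^-,x^+]\times Y')$. For $\Gamma=x_1:X_1,\dots,x_n:X_n$, $\overline\Gamma[x_n^-\dots x_1^-,x_n^+\dots x_1^+]$ denotes $x_1:\overline{X_1}[x_1^-,x_1^+],\dots,x_n:\overline{X_n}[x_n^-,x_n^+]$. A sequent $\overline\Gamma[\gamma^-,\gamma^+]\vdash t:\overline X[x^-,x^+]$ is well-labelled if the labels occurring in $\gamma^-,\gamma^+,x^-,x^+$ are pairwise distinct. -}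

module Defs where

open import Data.Nat using (ℕ; zero; suc; _+_; _⊔_)
open import Data.List using (List; []; _∷_; _++_)
open import Data.Vec using (Vec; []; _∷_; take; drop; toList)
open import Data.Product using (Σ; _×_; _,_; proj₁; proj₂)
open import Data.Unit using (⊤; tt)
open import Relation.Binary.PropositionalEquality using (_≡_; refl; subst; cong)
open import Data.List.Relation.Unary.Unique.Propositional using (Unique)

Name : Set
Name = ℕ

Label : Set
Label = ℕ

-- Contexts: finite lists  x₁:A₁, …, xₙ:Aₙ , written as snoc-lists
-- (ε ▸ (x₁ , A₁) ▸ … ▸ (xₙ , Aₙ)), so "Γ , x : A" is  Γ ▸ (x , A).

infixl 5 _▸_
data Cx (A : Set) : Set where
  ε   : Cx A
  _▸_ : Cx A → Name × A → Cx A

infixl 5 _⧺_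
_⧺_ : ∀ {A} → Cx A → Cx A → Cx A
Γ ⧺ ε       = Γ
Γ ⧺ (Δ ▸ a) = (Γ ⧺ Δ) ▸ a

mapCx : ∀ {A B : Set} → (A → B) → Cx A → Cx B
mapCx f ε             = ε
mapCx f (Γ ▸ (x , a)) = mapCx f Γ ▸ (x , f a)

mapCx-⧺ : ∀ {A B : Set} (f : A → B) (Γ Δ : Cx A) →
          mapCx f (Γ ⧺ Δ) ≡ mapCx f Γ ⧺ mapCx f Δ
mapCx-⧺ f Γ ε             = refl
mapCx-⧺ f Γ (Δ ▸ (x , a)) = cong (λ Θ → Θ ▸ (x , f a)) (mapCx-⧺ f Γ Δ)

ε⧺ : ∀ {A} (Γ : Cx A) → ε ⧺ Γ ≡ Γ
ε⧺ ε       = refl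
ε⧺ (Γ ▸ a) = cong (_▸ a) (ε⧺ Γ)

fresh : ∀ {A} → Cx A → Name
fresh ε             = 0
fresh (Γ ▸ (x , _)) = fresh Γ ⊔ suc x

infixr 7 _⇒_
data Ty : Set where
  𝟙   : Ty
  _⇒_ : Ty → Ty → Ty

data Tm : Set where
  `_     : Name → Tm
  ∗      : Tm
  ƛ_∶_∙_ : Name → Ty → Tm → Tm
  _·_    : Tm → Tm → Tm

data _⊢_∶_ : Cx Ty → Tm → Ty → Set where
  ax   : ∀ {x X} → (ε ▸ (x , X)) ⊢ ` x ∶ X
  1i   : ε ⊢ ∗ ∶ 𝟙
  weak : ∀ {Γ t Y x X} → Γ ⊢ t ∶ Y → (Γ ▸ (x , X)) ⊢ t ∶ Y
  exch : ∀ {Γ Δ x X y Y t Z} →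
         ((Γ ▸ (y , Y) ▸ (x , X)) ⧺ Δ) ⊢ t ∶ Z →
         ((Γ ▸ (x , X) ▸ (y , Y)) ⧺ Δ) ⊢ t ∶ Z
  →i   : ∀ {Γ x X t Y} → (Γ ▸ (x , X)) ⊢ t ∶ Y → Γ ⊢ (ƛ x ∶ X ∙ t) ∶ (X ⇒ Y)
  →e   : ∀ {Γ Δ s t X Y} → Γ ⊢ s ∶ (X ⇒ Y) → Δ ⊢ t ∶ X → (Γ ⧺ Δ) ⊢ (s · t) ∶ Y

-- Target calculus (with ⊥ and linear products), parametrised by the set
-- L of labels carried by arrows, abstractions and applications.
--   L = ⊤      : the unlabelled CPS target
--   L = Label  : the labelled calculus

data TTy (L : Set) : Set where
  𝟙       : TTy L
  ⊥'      : TTy L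
  _⟶⟨_⟩_ : TTy L → L → TTy L → TTy L
  _⊗_     : TTy L → TTy L → TTy L

data TTm (L : Set) : Set where
  var  : Name → TTm L
  ∗    : TTm L
  lam  : L → Name → TTm L → TTm L
  app  : TTm L → L → TTm L → TTm L
  pair : TTm L → TTm L → TTm L
  letp : TTm L → Name → Name → TTm L → TTm L

data TDer {L : Set} : Cx (TTy L) → TTm L → TTy L → Set where
  ax   : ∀ {x A} → TDer (ε ▸ (x , A)) (var x) A
  1i   : TDer ε ∗ 𝟙
  weak : ∀ {Γ t B x A} → TDer Γ t B → TDer (Γ ▸ (x , A)) t B
  exch : ∀ {Γ Δ x A y B t C} →
         TDer ((Γ ▸ (y , B) ▸ (x , A)) ⧺ Δ) t C →
         TDer ((Γ ▸ (x , A) ▸ (y , B)) ⧺ Δ) t C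
  →i   : ∀ {Γ x A t B l} → TDer (Γ ▸ (x , A)) t B → TDer Γ (lam l x t) (A ⟶⟨ l ⟩ B)
  →e   : ∀ {Γ Δ s t A B l} → TDer Γ s (A ⟶⟨ l ⟩ B) → TDer Δ t A →
         TDer (Γ ⧺ Δ) (app s l t) B
  ×i   : ∀ {Γ Δ s t A B} → TDer Γ s A → TDer Δ t B → TDer (Γ ⧺ Δ) (pair s t) (A ⊗ B)
  -- linear product elimination: body context Δ first, then the context of s
  ×e   : ∀ {Γ Δ s x y t A B C} → TDer Γ s (A ⊗ B) →
         TDer (Δ ▸ (x , A) ▸ (y , B)) t C → TDer (Δ ⧺ Γ) (letp s x y t) C

U : Set
U = TTy ⊤

¬_ : U → U
¬ A = A ⟶⟨ tt ⟩ ⊥'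

mutual
  cont : Ty → U
  cont 𝟙       = ¬ 𝟙
  cont (X ⇒ Y) = bar X ⊗ cont Y

  bar : Ty → U
  bar X = ¬ cont X

tr : ∀ {L} {Γ Γ' : Cx (TTy L)} {t A} → Γ ≡ Γ' → TDer Γ t A → TDer Γ' t A
tr refl d = d

sym'' : ∀ {A : Set} {a b : A} → a ≡ b → b ≡ a
sym'' refl = refl

barC : Cx Ty → Cx U
barC = mapCx bar

-- η-expansion η(t, A); all names ≥ n are used as fresh names
etaTm : Name → TTm ⊤ → U → TTm ⊤
etaTm n t 𝟙              = t
etaTm n t ⊥'             = t
etaTm n t (A ⊗ B)        =
  letp t n (suc n) (pair (etaTm (suc (suc n)) (var n) A)
                         (etaTm (suc (suc n)) (var (suc n)) B))
etaTm n t (A ⟶⟨ _ ⟩ B) =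
  lam tt n (etaTm (suc n) (app t tt (etaTm (suc n) (var n) A)) B)

etaDer : ∀ {Γ t} (n : Name) (A : U) → TDer Γ t A → TDer Γ (etaTm n t A) A
etaDer n 𝟙 d = d
etaDer n ⊥' d = d
etaDer {Γ} n (A ⊗ B) d =
  tr (ε⧺ Γ)
    (×e d (×i (etaDer (suc (suc n)) A ax) (etaDer (suc (suc n)) B ax)))
etaDer n (A ⟶⟨ tt ⟩ B) d = →i (etaDer (suc n) B (→e d (etaDer (suc n) A ax)))

cpsTm : ∀ {Γ t X} → Γ ⊢ t ∶ X → TTm ⊤
cpsTm (ax {x} {X})      = etaTm (suc x) (var x) (bar X)
cpsTm 1i                = lam tt 0 (app (var 0) tt ∗)
cpsTm (weak d)          = cpsTm d
cpsTm (exch d)          = cpsTm d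
cpsTm (→i {Γ} {x} {X} d) =
  -- λ<x,k>. t̲ k  =  λz. let z be <x,k> in t̲ k
  let z = fresh (Γ ▸ (x , X)) in
  lam tt z (letp (var z) x (suc z) (app (cpsTm d) tt (var (suc z))))
cpsTm (→e {Γ} {Δ} ds dt) =
  let k = fresh (Γ ⧺ Δ) in
  lam tt k (app (cpsTm ds) tt (pair (cpsTm dt) (var k)))

cps : ∀ {Γ t X} (d : Γ ⊢ t ∶ X) → TDer (barC Γ) (cpsTm d) (bar X)
cps (ax {x} {X}) = etaDer (suc x) (bar X) ax
cps 1i = →i (→e ax 1i)
cps (weak d) = weak (cps d)
cps (exch {Γ} {Δ} {x} {X} {y} {Y} d) =
  tr (sym'' (mapCx-⧺ bar (Γ ▸ (x , X) ▸ (y , Y)) Δ))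
    (exch (tr (mapCx-⧺ bar (Γ ▸ (y , Y) ▸ (x , X)) Δ) (cps d)))
cps (→i d) = →i (×e ax (→e (cps d) ax))
cps (→e {Γ} {Δ} ds dt) =
  tr (sym'' (mapCx-⧺ bar Γ Δ)) (→i (→e (cps ds) (×i (cps dt) ax)))

mapTTy : ∀ {L M : Set} → (L → M) → TTy L → TTy M
mapTTy f 𝟙            = 𝟙
mapTTy f ⊥'           = ⊥'
mapTTy f (A ⟶⟨ l ⟩ B) = mapTTy f A ⟶⟨ f l ⟩ mapTTy f B
mapTTy f (A ⊗ B)      = mapTTy f A ⊗ mapTTy f B

mapTTm : ∀ {L M : Set} → (L → M) → TTm L → TTm M
mapTTm f (var x)        = var x
mapTTm f ∗              = ∗
mapTTm f (lam l x t)    = lam (f l) x (mapTTm f t)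
mapTTm f (app s l t)    = app (mapTTm f s) (f l) (mapTTm f t)
mapTTm f (pair s t)     = pair (mapTTm f s) (mapTTm f t)
mapTTm f (letp s x y t) = letp (mapTTm f s) x y (mapTTm f t)

eraseTy : TTy Label → U
eraseTy = mapTTy (λ _ → tt)

eraseTm : TTm Label → TTm ⊤
eraseTm = mapTTm (λ _ → tt)

eraseCx : Cx (TTy Label) → Cx U
eraseCx = mapCx eraseTy

eraseDer : ∀ {Γ t A} → TDer {Label} Γ t A → TDer (eraseCx Γ) (eraseTm t) (eraseTy A)
eraseDer ax = ax
eraseDer 1i = 1i
eraseDer (weak d) = weak (eraseDer d)
eraseDer (exch {Γ} {Δ} {x} {A} {y} {B} d) =
  tr (sym'' (mapCx-⧺ eraseTy (Γ ▸ (x , A) ▸ (y , B)) Δ))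
    (exch (tr (mapCx-⧺ eraseTy (Γ ▸ (y , B) ▸ (x , A)) Δ) (eraseDer d)))
eraseDer (→i d) = →i (eraseDer d)
eraseDer (→e {Γ} {Δ} ds dt) =
  tr (sym'' (mapCx-⧺ eraseTy Γ Δ)) (→e (eraseDer ds) (eraseDer dt))
eraseDer (×i {Γ} {Δ} ds dt) =
  tr (sym'' (mapCx-⧺ eraseTy Γ Δ)) (×i (eraseDer ds) (eraseDer dt))
eraseDer (×e {Γ} {Δ} ds dt) =
  tr (sym'' (mapCx-⧺ eraseTy Δ Γ)) (×e (eraseDer ds) (eraseDer dt))

transport : ∀ {Γ Γ' t t' A A'} → Γ ≡ Γ' → t ≡ t' → A ≡ A' →
            TDer {⊤} Γ t A → TDer Γ' t' A'
transport refl refl refl d = d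

_Annotates_ : ∀ {Γ' t' A' Γ t A} → TDer {Label} Γ' t' A' → TDer {⊤} Γ t A → Set
_Annotates_ {Γ'} {t'} {A'} {Γ} {t} {A} d' d =
  Σ (eraseCx Γ' ≡ Γ) λ eΓ → Σ (eraseTm t' ≡ t) λ et → Σ (eraseTy A' ≡ A) λ eA →
    transport eΓ et eA (eraseDer d') ≡ d

absLabels : ∀ {L} → TTm L → List L
absLabels (var x)        = []
absLabels ∗              = []
absLabels (lam l x t)    = l ∷ absLabels t
absLabels (app s l t)    = absLabels s ++ absLabels t
absLabels (pair s t)     = absLabels s ++ absLabels t
absLabels (letp s x y t) = absLabels s ++ absLabels t

neg pos : Ty → ℕ
neg 𝟙       = 1
neg (X ⇒ Y) = neg Y + pos X
pos 𝟙       = 1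
pos (X ⇒ Y) = pos Y + neg X

¬⟨_⟩_ : Label → TTy Label → TTy Label
¬⟨ l ⟩ A = A ⟶⟨ l ⟩ ⊥'

mutual
  -- barL X x⁻ x⁺ = (q , Y')  means  X̄[x⁻,x⁺] = ¬_q Y'
  barL : (X : Ty) → Vec Label (neg X) → Vec Label (pos X) → Label × TTy Label
  barL 𝟙 (q ∷ []) (a ∷ []) = q , ¬⟨ a ⟩ 𝟙
  barL (X ⇒ Y) xm xp =
    -- xm = y⁻ x⁺ ,  xp = y⁺ x⁻
    proj₁ (barL Y (take (neg Y) xm) (take (pos Y) xp)) ,
    (barTy X (drop (pos Y) xp) (drop (neg Y) xm)
      ⊗ proj₂ (barL Y (take (neg Y) xm) (take (pos Y) xp)))

  barTy : (X : Ty) → Vec Label (neg X) → Vec Label (pos X) → TTy Label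
  barTy X xm xp = ¬⟨ proj₁ (barL X xm xp) ⟩ proj₂ (barL X xm xp)

negC posC : Cx Ty → ℕ
negC ε             = 0
negC (Γ ▸ (x , X)) = neg X + negC Γ
posC ε             = 0
posC (Γ ▸ (x , X)) = pos X + posC Γ

-- Γ̄[xₙ⁻ … x₁⁻ , xₙ⁺ … x₁⁺]  for Γ = x₁:X₁,…,xₙ:Xₙ
barCx : (Γ : Cx Ty) → Vec Label (negC Γ) → Vec Label (posC Γ) → Cx (TTy Label)
barCx ε gm gp = ε
barCx (Γ ▸ (x , X)) gm gp =
  barCx Γ (drop (neg X) gm) (drop (pos X) gp) ▸ (x , barTy X (take (neg X) gm) (take (pos X) gp))

WellLabelled : ∀ {a b c d} → Vec Label a → Vec Label b → Vec Label c → Vec Label d → Set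
WellLabelled gm gp xm xp = Unique (toList gm ++ toList gp ++ toList xm ++ toList xp)

module Submission where

-- The CPS derivation  cps d  is labelled by recursion on d, against an
-- arbitrary labelled sequent  Γ' ⊢ A  that erases to the translated sequent
-- and a supply of fresh labels  b, b+1, … .  Applications carry the label
-- dictated by the type of their function; every abstraction receives either
-- a label available in the sequent (occurring negatively in a hypothesis or
-- positively in the conclusion) or a fresh label from the supply.  This is
-- the invariant recorded by an  Annotation : each label occurs among the
-- abstraction labels at most as often as it is available, plus once if it
-- was drawn from the supply.  The axiom rule needs a labelled η-expansion
-- between two labellings of the same type; the rule (→e) labels the type of
-- the argument freshly.  For the theorem, the interface is labelled with the
-- consecutive labels 0, 1, …, N-1 and the supply starts at N; then every
-- label has total multiplicity at most one, which gives both uniqueness of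
-- the abstraction labels and well-labelledness of the sequent.

open import Defs
open import Data.Vec using (Vec; []; _∷_; take; drop; toList)
open import Data.Product using (Σ; _×_; _,_; proj₁; proj₂)
open import Data.List using (List; []; _∷_; _++_)
open import Data.List.Relation.Unary.All using (All; []; _∷_)
open import Data.List.Relation.Unary.AllPairs using ([]; _∷_)
open import Data.List.Relation.Unary.Unique.Propositional using (Unique)
open import Data.Nat using (ℕ; zero; suc; _+_; _≤_; _<_; z≤n; s≤s)
open import Data.Nat.Properties
open import Data.Nat.Tactic.RingSolver using (solve-∀)
open import Data.Sum using (_⊎_; inj₁; inj₂)
open import Data.Unit using (⊤; tt)
open import Relation.Binary.PropositionalEquality

δ : Label → Label → ℕ
δ zero    zero    = 1
δ zero    (suc _) = 0
δ (suc _) zero    = 0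
δ (suc m) (suc l) = δ m l

δ-self : ∀ m → δ m m ≡ 1
δ-self zero    = refl
δ-self (suc m) = δ-self m

δ-cases : ∀ m l → δ m l ≡ 0 ⊎ m ≡ l
δ-cases zero    zero    = inj₂ refl
δ-cases zero    (suc l) = inj₁ refl
δ-cases (suc m) zero    = inj₁ refl
δ-cases (suc m) (suc l) with δ-cases m l
... | inj₁ e = inj₁ e
... | inj₂ e = inj₂ (cong suc e)

δ-< : ∀ m l → l < m → δ m l ≡ 0
δ-< (suc m) zero    _       = refl
δ-< (suc m) (suc l) (s≤s p) = δ-< m l p

occ : List Label → Label → ℕ
occ []       l = 0
occ (m ∷ ms) l = δ m l + occ ms l

occ-++ : ∀ xs ys l → occ (xs ++ ys) l ≡ occ xs l + occ ys l
occ-++ []       ys l = refl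
occ-++ (x ∷ xs) ys l =
  trans (cong (δ x l +_) (occ-++ xs ys l)) (sym (+-assoc (δ x l) _ _))

occ-++₄ : ∀ as bs cs ds l →
  occ (as ++ bs ++ cs ++ ds) l ≡ occ as l + occ bs l + (occ cs l + occ ds l)
occ-++₄ as bs cs ds l
  rewrite occ-++ as (bs ++ cs ++ ds) l | occ-++ bs (cs ++ ds) l | occ-++ cs ds l =
  sym (+-assoc (occ as l) _ _)

occ≡0⇒All≢ : ∀ x ys → occ ys x ≡ 0 → All (x ≢_) ys
occ≡0⇒All≢ x []       e = []
occ≡0⇒All≢ x (y ∷ ys) e = x≢y ∷ occ≡0⇒All≢ x ys (m+n≡0⇒n≡0 (δ y x) e)
  where
    x≢y : x ≢ y
    x≢y refl = 1+n≢0 (trans (sym (δ-self x)) (m+n≡0⇒m≡0 (δ x x) e))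

occ≤1⇒Unique : ∀ xs → (∀ l → occ xs l ≤ 1) → Unique xs
occ≤1⇒Unique []       h = []
occ≤1⇒Unique (x ∷ xs) h =
  occ≡0⇒All≢ x xs (n≤0⇒n≡0 (≤-pred (subst (λ k → k + occ xs x ≤ 1) (δ-self x) (h x)))) ∷
  occ≤1⇒Unique xs (λ l → ≤-trans (m≤n+m (occ xs l) (δ x l)) (h l))

occ-take-drop : ∀ m {n} (v : Vec Label (m + n)) l →
  occ (toList v) l ≡ occ (toList (take m v)) l + occ (toList (drop m v)) l
occ-take-drop zero    v       l = refl
occ-take-drop (suc m) (x ∷ v) l =
  trans (cong (δ x l +_) (occ-take-drop m v l)) (sym (+-assoc (δ x l) _ _))

block : (b n : ℕ) → Vec Label n
block b zero    = []
block b (suc n) = b ∷ block (suc b) n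

blockOcc : ℕ → ℕ → Label → ℕ
blockOcc b zero    l = 0
blockOcc b (suc n) l = δ b l + blockOcc (suc b) n l

occ-block : ∀ b n l → occ (toList (block b n)) l ≡ blockOcc b n l
occ-block b zero    l = refl
occ-block b (suc n) l = cong (δ b l +_) (occ-block (suc b) n l)

blockOcc-split : ∀ b m n l → blockOcc b (m + n) l ≡ blockOcc b m l + blockOcc (b + m) n l
blockOcc-split b zero    n l rewrite +-identityʳ b = refl
blockOcc-split b (suc m) n l rewrite blockOcc-split (suc b) m n l | +-suc b m =
  sym (+-assoc (δ b l) _ _)

blockOcc-below : ∀ b n l → l < b → blockOcc b n l ≡ 0
blockOcc-below b zero    l p = refl
blockOcc-below b (suc n) l p rewrite δ-< b l p =
  blockOcc-below (suc b) n l (≤-trans p (n≤1+n b))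

blockOcc≤1 : ∀ b n l → blockOcc b n l ≤ 1
blockOcc≤1 b zero    l = z≤n
blockOcc≤1 b (suc n) l with δ-cases b l
... | inj₁ e    rewrite e = blockOcc≤1 (suc b) n l
... | inj₂ refl rewrite δ-self b | blockOcc-below (suc b) n b ≤-refl = s≤s z≤n

LCx : Set
LCx = Cx (TTy Label)

posOcc negOcc : TTy Label → Label → ℕ
posOcc 𝟙            l = 0
posOcc ⊥'           l = 0
posOcc (A ⟶⟨ m ⟩ B) l = δ m l + negOcc A l + posOcc B l
posOcc (A ⊗ B)      l = posOcc A l + posOcc B l
negOcc 𝟙            l = 0
negOcc ⊥'           l = 0
negOcc (A ⟶⟨ m ⟩ B) l = posOcc A l + negOcc B l
negOcc (A ⊗ B)      l = negOcc A l + negOcc B l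

negOccCx posOccCx : LCx → Label → ℕ
negOccCx ε             l = 0
negOccCx (Γ ▸ (x , A)) l = negOccCx Γ l + negOcc A l
posOccCx ε             l = 0
posOccCx (Γ ▸ (x , A)) l = posOccCx Γ l + posOcc A l

negOccCx-⧺ : ∀ Γ Δ l → negOccCx (Γ ⧺ Δ) l ≡ negOccCx Γ l + negOccCx Δ l
negOccCx-⧺ Γ ε             l = sym (+-identityʳ _)
negOccCx-⧺ Γ (Δ ▸ (x , A)) l =
  trans (cong (_+ negOcc A l) (negOccCx-⧺ Γ Δ l)) (+-assoc (negOccCx Γ l) _ _)

-- Labels available for abstractions in the sequent  Γ ⊢ A : those that
-- occur negatively in a hypothesis or positively in the conclusion.
available : LCx → TTy Label → Label → ℕ
available Γ A l = negOccCx Γ l + posOcc A l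

available-exch : ∀ Γ Δ x y S T A l →
  available ((Γ ▸ (y , T) ▸ (x , S)) ⧺ Δ) A l ≡ available ((Γ ▸ (x , S) ▸ (y , T)) ⧺ Δ) A l
available-exch Γ Δ x y S T A l
  rewrite negOccCx-⧺ (Γ ▸ (y , T) ▸ (x , S)) Δ l | negOccCx-⧺ (Γ ▸ (x , S) ▸ (y , T)) Δ l =
  swap (negOccCx Γ l) (negOcc T l) (negOcc S l) (negOccCx Δ l) (posOcc A l)
  where
    swap : ∀ g t s d a → g + t + s + d + a ≡ g + s + t + d + a
    swap = solve-∀

-- d₁ ≈ d₂ : the two derivations coincide after identifying their sequents.
-- In particular  d' Annotates d  is  eraseDer d' ≈ d .
_≈_ : ∀ {Γ₁ t₁ A₁ Γ₂ t₂ A₂} → TDer {⊤} Γ₁ t₁ A₁ → TDer {⊤} Γ₂ t₂ A₂ → Set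
_≈_ {Γ₁} {t₁} {A₁} {Γ₂} {t₂} {A₂} d₁ d₂ =
  Σ (Γ₁ ≡ Γ₂) λ eΓ → Σ (t₁ ≡ t₂) λ et → Σ (A₁ ≡ A₂) λ eA → transport eΓ et eA d₁ ≡ d₂

≈-refl : ∀ {Γ t A} (d : TDer {⊤} Γ t A) → d ≈ d
≈-refl d = refl , refl , refl , refl

≈-trL : ∀ {Γ Γ' t A Γ₂ t₂ A₂} (p : Γ ≡ Γ') {d₁ : TDer {⊤} Γ t A} {d₂ : TDer {⊤} Γ₂ t₂ A₂} →
        d₁ ≈ d₂ → tr p d₁ ≈ d₂
≈-trL refl h = h

≈-trR : ∀ {Γ Γ' t A Γ₁ t₁ A₁} (p : Γ ≡ Γ') {d₁ : TDer {⊤} Γ₁ t₁ A₁} {d₂ : TDer {⊤} Γ t A} →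
        d₁ ≈ d₂ → d₁ ≈ tr p d₂
≈-trR refl h = h

≈-erase-tr : ∀ {Γ Γ' t A Γ₂ t₂ A₂} (p : Γ ≡ Γ') (d : TDer {Label} Γ t A)
             {d₂ : TDer {⊤} Γ₂ t₂ A₂} → eraseDer d ≈ d₂ → eraseDer (tr p d) ≈ d₂
≈-erase-tr refl d h = h

≈-ax : ∀ {x A₁ A₂} → A₁ ≡ A₂ → ax {⊤} {x} {A₁} ≈ ax {⊤} {x} {A₂}
≈-ax refl = refl , refl , refl , refl

≈-weak : ∀ {Γ₁ t₁ B₁ Γ₂ t₂ B₂ x A₁ A₂} {d₁ : TDer {⊤} Γ₁ t₁ B₁} {d₂ : TDer {⊤} Γ₂ t₂ B₂} →
         A₁ ≡ A₂ → d₁ ≈ d₂ → weak {x = x} {A = A₁} d₁ ≈ weak {x = x} {A = A₂} d₂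
≈-weak refl (refl , refl , refl , refl) = refl , refl , refl , refl

≈-exch : ∀ {Γ₁ Δ₁ Γ₂ Δ₂ x A₁ A₂ y B₁ B₂ t₁ t₂ C₁ C₂}
           {d₁ : TDer {⊤} ((Γ₁ ▸ (y , B₁) ▸ (x , A₁)) ⧺ Δ₁) t₁ C₁}
           {d₂ : TDer {⊤} ((Γ₂ ▸ (y , B₂) ▸ (x , A₂)) ⧺ Δ₂) t₂ C₂} →
           Γ₁ ≡ Γ₂ → Δ₁ ≡ Δ₂ → A₁ ≡ A₂ → B₁ ≡ B₂ → d₁ ≈ d₂ →
           exch {Γ = Γ₁} {Δ = Δ₁} {x = x} {A = A₁} {y = y} {B = B₁} d₁
             ≈ exch {Γ = Γ₂} {Δ = Δ₂} {x = x} {A = A₂} {y = y} {B = B₂} d₂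
≈-exch refl refl refl refl (refl , refl , refl , refl) = refl , refl , refl , refl

≈-→i : ∀ {Γ₁ x₁ A₁ t₁ B₁ Γ₂ x₂ A₂ t₂ B₂}
         {d₁ : TDer {⊤} (Γ₁ ▸ (x₁ , A₁)) t₁ B₁} {d₂ : TDer {⊤} (Γ₂ ▸ (x₂ , A₂)) t₂ B₂} →
         d₁ ≈ d₂ → →i {l = tt} d₁ ≈ →i {l = tt} d₂
≈-→i (refl , refl , refl , refl) = refl , refl , refl , refl

≈-→e : ∀ {Γ₁ Δ₁ s₁ u₁ A₁ B₁ Γ₂ Δ₂ s₂ u₂ A₂ B₂}
         {d₁ : TDer {⊤} Γ₁ s₁ (A₁ ⟶⟨ tt ⟩ B₁)} {e₁ : TDer {⊤} Δ₁ u₁ A₁}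
         {d₂ : TDer {⊤} Γ₂ s₂ (A₂ ⟶⟨ tt ⟩ B₂)} {e₂ : TDer {⊤} Δ₂ u₂ A₂} →
         d₁ ≈ d₂ → e₁ ≈ e₂ → →e d₁ e₁ ≈ →e d₂ e₂
≈-→e (refl , refl , refl , refl) (refl , refl , refl , refl) = refl , refl , refl , refl

≈-×i : ∀ {Γ₁ Δ₁ s₁ u₁ A₁ B₁ Γ₂ Δ₂ s₂ u₂ A₂ B₂}
         {d₁ : TDer {⊤} Γ₁ s₁ A₁} {e₁ : TDer {⊤} Δ₁ u₁ B₁}
         {d₂ : TDer {⊤} Γ₂ s₂ A₂} {e₂ : TDer {⊤} Δ₂ u₂ B₂} →
         d₁ ≈ d₂ → e₁ ≈ e₂ → ×i d₁ e₁ ≈ ×i d₂ e₂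
≈-×i (refl , refl , refl , refl) (refl , refl , refl , refl) = refl , refl , refl , refl

≈-×e : ∀ {Γ₁ Δ₁ s₁ x y u₁ A₁ B₁ C₁ Γ₂ Δ₂ s₂ u₂ A₂ B₂ C₂}
         {d₁ : TDer {⊤} Γ₁ s₁ (A₁ ⊗ B₁)} {e₁ : TDer {⊤} (Δ₁ ▸ (x , A₁) ▸ (y , B₁)) u₁ C₁}
         {d₂ : TDer {⊤} Γ₂ s₂ (A₂ ⊗ B₂)} {e₂ : TDer {⊤} (Δ₂ ▸ (x , A₂) ▸ (y , B₂)) u₂ C₂} →
         d₁ ≈ d₂ → e₁ ≈ e₂ → ×e d₁ e₁ ≈ ×e d₂ e₂
≈-×e (refl , refl , refl , refl) (refl , refl , refl , refl) = refl , refl , refl , refl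

invert-ε : ∀ (Γ' : LCx) → eraseCx Γ' ≡ ε → Γ' ≡ ε
invert-ε ε       refl = refl
invert-ε (_ ▸ _) ()

invert-▸ : ∀ (Γ' : LCx) {Γ x V} → eraseCx Γ' ≡ Γ ▸ (x , V) →
  Σ LCx λ Γ₁ → Σ (TTy Label) λ S → (Γ' ≡ Γ₁ ▸ (x , S)) × (eraseCx Γ₁ ≡ Γ) × (eraseTy S ≡ V)
invert-▸ ε ()
invert-▸ (Γ₁ ▸ (y , S)) refl = Γ₁ , S , refl , refl , refl

invert-⧺ : ∀ (Γ' : LCx) Γ Δ → eraseCx Γ' ≡ Γ ⧺ Δ →
  Σ LCx λ Γ₁ → Σ LCx λ Δ₁ → (Γ' ≡ Γ₁ ⧺ Δ₁) × (eraseCx Γ₁ ≡ Γ) × (eraseCx Δ₁ ≡ Δ)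
invert-⧺ Γ' Γ ε e = Γ' , ε , refl , e , refl
invert-⧺ Γ' Γ (Δ ▸ (x , V)) e with invert-▸ Γ' e
... | Γ'' , S , refl , e'' , refl with invert-⧺ Γ'' Γ Δ e''
... | Γ₁ , Δ₁ , refl , eΓ , eΔ = Γ₁ , (Δ₁ ▸ (x , S)) , refl , eΓ , cong (_▸ (x , eraseTy S)) eΔ

invert-¬ : ∀ (A : TTy Label) {V} → eraseTy A ≡ ¬ V →
  Σ (TTy Label) λ A₁ → Σ Label λ q → (A ≡ ¬⟨ q ⟩ A₁) × (eraseTy A₁ ≡ V)
invert-¬ 𝟙 ()
invert-¬ ⊥' ()
invert-¬ (A₁ ⟶⟨ q ⟩ 𝟙) ()
invert-¬ (A₁ ⟶⟨ q ⟩ ⊥') refl = A₁ , q , refl , refl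
invert-¬ (A₁ ⟶⟨ q ⟩ (_ ⟶⟨ _ ⟩ _)) ()
invert-¬ (A₁ ⟶⟨ q ⟩ (_ ⊗ _)) ()
invert-¬ (_ ⊗ _) ()

invert-⊗ : ∀ (A : TTy Label) {V W} → eraseTy A ≡ V ⊗ W →
  Σ (TTy Label) λ A₁ → Σ (TTy Label) λ A₂ →
  (A ≡ A₁ ⊗ A₂) × (eraseTy A₁ ≡ V) × (eraseTy A₂ ≡ W)
invert-⊗ 𝟙 ()
invert-⊗ ⊥' ()
invert-⊗ (_ ⟶⟨ _ ⟩ _) ()
invert-⊗ (A₁ ⊗ A₂) refl = A₁ , A₂ , refl , refl , refl

invert-𝟙 : ∀ (A : TTy Label) → eraseTy A ≡ 𝟙 → A ≡ 𝟙
invert-𝟙 𝟙 refl = refl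
invert-𝟙 ⊥' ()
invert-𝟙 (_ ⟶⟨ _ ⟩ _) ()
invert-𝟙 (_ ⊗ _) ()

-- Two labelled types with the same erasure.  Arrows are contravariant in
-- the domain, matching the direction in which η-expansion converts.
data SameShape : TTy Label → TTy Label → Set where
  𝟙-𝟙 : SameShape 𝟙 𝟙
  ⊥-⊥ : SameShape ⊥' ⊥'
  ⊗-⊗ : ∀ {S₁ S₂ T₁ T₂} → SameShape S₁ T₁ → SameShape S₂ T₂ → SameShape (S₁ ⊗ S₂) (T₁ ⊗ T₂)
  ⟶-⟶ : ∀ {S₁ S₂ T₁ T₂ m n} → SameShape T₁ S₁ → SameShape S₂ T₂ →
        SameShape (S₁ ⟶⟨ m ⟩ S₂) (T₁ ⟶⟨ n ⟩ T₂)

sameShape : ∀ S T → eraseTy S ≡ eraseTy T → SameShape S T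
sameShape 𝟙 𝟙 e = 𝟙-𝟙
sameShape ⊥' ⊥' e = ⊥-⊥
sameShape (S₁ ⟶⟨ _ ⟩ S₂) (T₁ ⟶⟨ _ ⟩ T₂) e =
  ⟶-⟶ (sameShape T₁ S₁ (cong dom (sym e))) (sameShape S₂ T₂ (cong cod e))
  where
    dom cod : TTy ⊤ → TTy ⊤
    dom (A ⟶⟨ _ ⟩ _) = A
    dom A            = A
    cod (_ ⟶⟨ _ ⟩ B) = B
    cod A            = A
sameShape (S₁ ⊗ S₂) (T₁ ⊗ T₂) e =
  ⊗-⊗ (sameShape S₁ T₁ (cong fst e)) (sameShape S₂ T₂ (cong snd e))
  where
    fst snd : TTy ⊤ → TTy ⊤
    fst (A ⊗ _) = A
    fst A       = A
    snd (_ ⊗ B) = B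
    snd A       = A
sameShape 𝟙 ⊥' ()
sameShape 𝟙 (_ ⟶⟨ _ ⟩ _) ()
sameShape 𝟙 (_ ⊗ _) ()
sameShape ⊥' 𝟙 ()
sameShape ⊥' (_ ⟶⟨ _ ⟩ _) ()
sameShape ⊥' (_ ⊗ _) ()
sameShape (_ ⟶⟨ _ ⟩ _) 𝟙 ()
sameShape (_ ⟶⟨ _ ⟩ _) ⊥' ()
sameShape (_ ⟶⟨ _ ⟩ _) (_ ⊗ _) ()
sameShape (_ ⊗ _) 𝟙 ()
sameShape (_ ⊗ _) ⊥' ()
sameShape (_ ⊗ _) (_ ⟶⟨ _ ⟩ _) ()

sameShape-erase : ∀ {S T} → SameShape S T → eraseTy S ≡ eraseTy T
sameShape-erase 𝟙-𝟙 = refl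
sameShape-erase ⊥-⊥ = refl
sameShape-erase (⊗-⊗ a b) = cong₂ _⊗_ (sameShape-erase a) (sameShape-erase b)
sameShape-erase (⟶-⟶ a b) = cong₂ (λ u v → u ⟶⟨ tt ⟩ v) (sym (sameShape-erase a)) (sameShape-erase b)

-- η(t, ·) converting a term of type S into one of type T: abstractions get
-- the labels of T, applications those of S.  Names ≥ n are fresh.
ηL : ∀ {S T} → Name → TTm Label → SameShape S T → TTm Label
ηL n t 𝟙-𝟙 = t
ηL n t ⊥-⊥ = t
ηL n t (⊗-⊗ a b) =
  letp t n (suc n) (pair (ηL (suc (suc n)) (var n) a) (ηL (suc (suc n)) (var (suc n)) b))
ηL n t (⟶-⟶ {m = m} {n = k} a b) =
  lam k n (ηL (suc n) (app t m (ηL (suc n) (var n) a)) b)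

ηL-der : ∀ {Γ t S T} n (sh : SameShape S T) → TDer Γ t S → TDer Γ (ηL n t sh) T
ηL-der n 𝟙-𝟙 d = d
ηL-der n ⊥-⊥ d = d
ηL-der {Γ} n (⊗-⊗ a b) d =
  tr (ε⧺ Γ) (×e d (×i (ηL-der (suc (suc n)) a ax) (ηL-der (suc (suc n)) b ax)))
ηL-der n (⟶-⟶ a b) d = →i (ηL-der (suc n) b (→e d (ηL-der (suc n) a ax)))

ηL-annotates : ∀ {Γ t S T} n (sh : SameShape S T) (d : TDer Γ t S)
  {Γ₀ t₀ V} (u : TDer Γ₀ t₀ V) →
  eraseTy T ≡ V → eraseDer d ≈ u → eraseDer (ηL-der n sh d) ≈ etaDer n V u
ηL-annotates n 𝟙-𝟙 d u refl h = h
ηL-annotates n ⊥-⊥ d u refl h = h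
ηL-annotates {Γ} n (⊗-⊗ a b) d {Γ₀} u refl h =
  ≈-erase-tr (ε⧺ Γ) _ (≈-trR (ε⧺ Γ₀) (≈-trL _ (≈-×e h (≈-trL _ (≈-×i
    (ηL-annotates (suc (suc n)) a ax ax refl (≈-ax (sameShape-erase a)))
    (ηL-annotates (suc (suc n)) b ax ax refl (≈-ax (sameShape-erase b))))))))
ηL-annotates n (⟶-⟶ {T₁ = T₁} a b) d u refl h =
  ≈-→i (ηL-annotates (suc n) b _ (→e u (etaDer (suc n) (eraseTy T₁) ax)) refl
    (≈-trL _ (≈-→e h (ηL-annotates (suc n) a ax ax (sym (sameShape-erase a)) (≈-refl _)))))

ηL-occ : ∀ {S T} n t (sh : SameShape S T) l →
  occ (absLabels (ηL n t sh)) l ≤ occ (absLabels t) l + (negOcc S l + posOcc T l)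
ηL-occ n t 𝟙-𝟙 l = m≤m+n _ _
ηL-occ n t ⊥-⊥ l = m≤m+n _ _
ηL-occ n t (⊗-⊗ {S₁} {S₂} {T₁} {T₂} a b) l
  rewrite occ-++ (absLabels t) (absLabels (ηL (suc (suc n)) (var n) a) ++
                                absLabels (ηL (suc (suc n)) (var (suc n)) b)) l
        | occ-++ (absLabels (ηL (suc (suc n)) (var n) a))
                 (absLabels (ηL (suc (suc n)) (var (suc n)) b)) l =
  ≤-trans (+-monoʳ-≤ (occ (absLabels t) l)
            (+-mono-≤ (ηL-occ (suc (suc n)) (var n) a l) (ηL-occ (suc (suc n)) (var (suc n)) b l)))
          (≤-reflexive (regroup (occ (absLabels t) l) (negOcc S₁ l) (negOcc S₂ l) (posOcc T₁ l) (posOcc T₂ l)))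
  where
    regroup : ∀ o a b c d → o + ((0 + (a + c)) + (0 + (b + d))) ≡ o + ((a + b) + (c + d))
    regroup = solve-∀
ηL-occ n t (⟶-⟶ {S₁} {S₂} {T₁} {T₂} {m} {k} a b) l =
  ≤-trans (+-monoʳ-≤ (δ k l) (ηL-occ (suc n) (app t m (ηL (suc n) (var n) a)) b l))
  (≤-trans (≤-reflexive (cong (λ z → δ k l + (z + (negOcc S₂ l + posOcc T₂ l)))
                          (occ-++ (absLabels t) (absLabels (ηL (suc n) (var n) a)) l)))
  (≤-trans (+-monoʳ-≤ (δ k l) (+-monoˡ-≤ (negOcc S₂ l + posOcc T₂ l)
             (+-monoʳ-≤ (occ (absLabels t) l) (ηL-occ (suc n) (var n) a l))))
  (≤-reflexive (regroup (δ k l) (occ (absLabels t) l) (negOcc T₁ l) (posOcc S₁ l) (negOcc S₂ l) (posOcc T₂ l)))))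
  where
    regroup : ∀ k o a b c d → k + ((o + (0 + (a + b))) + (c + d)) ≡ o + ((b + c) + (k + a + d))
    regroup = solve-∀

freshLabelling : (V : U) (b : ℕ) → Σ (TTy Label) λ F → Σ ℕ λ n →
  (eraseTy F ≡ V) × (∀ l → posOcc F l + negOcc F l ≤ blockOcc b n l)
freshLabelling 𝟙 b = 𝟙 , 0 , refl , λ l → z≤n
freshLabelling ⊥' b = ⊥' , 0 , refl , λ l → z≤n
freshLabelling (V₁ ⊗ V₂) b with freshLabelling V₁ b
... | F₁ , n₁ , e₁ , c₁ with freshLabelling V₂ (b + n₁)
... | F₂ , n₂ , e₂ , c₂ = F₁ ⊗ F₂ , n₁ + n₂ , cong₂ _⊗_ e₁ e₂ , λ l →
  ≤-trans (≤-reflexive (regroup (posOcc F₁ l) (posOcc F₂ l) (negOcc F₁ l) (negOcc F₂ l)))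
  (≤-trans (+-mono-≤ (c₁ l) (c₂ l)) (≤-reflexive (sym (blockOcc-split b n₁ n₂ l))))
  where
    regroup : ∀ a b c d → (a + b) + (c + d) ≡ (a + c) + (b + d)
    regroup = solve-∀
freshLabelling (V₁ ⟶⟨ _ ⟩ V₂) b with freshLabelling V₁ (suc b)
... | F₁ , n₁ , e₁ , c₁ with freshLabelling V₂ (suc b + n₁)
... | F₂ , n₂ , e₂ , c₂ =
  F₁ ⟶⟨ b ⟩ F₂ , suc (n₁ + n₂) , cong₂ (λ u v → u ⟶⟨ tt ⟩ v) e₁ e₂ , λ l →
  ≤-trans (≤-reflexive (regroup (δ b l) (posOcc F₁ l) (negOcc F₁ l) (posOcc F₂ l) (negOcc F₂ l)))
  (≤-trans (+-monoʳ-≤ (δ b l) (+-mono-≤ (c₁ l) (c₂ l)))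
    (≤-reflexive (cong (δ b l +_) (sym (blockOcc-split (suc b) n₁ n₂ l)))))
  where
    regroup : ∀ i a b c d → (i + b + c) + (a + d) ≡ i + ((a + b) + (c + d))
    regroup = solve-∀

record Annotation (Γ' : LCx) (A : TTy Label) {Γ : Cx U} {t : TTm ⊤} {V : U}
                  (u : TDer {⊤} Γ t V) (b : ℕ) : Set where
  constructor annotation
  field
    term      : TTm Label
    der       : TDer Γ' term A
    annotates : eraseDer der ≈ u
    used      : ℕ
    bound     : ∀ l → occ (absLabels term) l ≤ available Γ' A l + blockOcc b used l

annotate-ax : ∀ {x X} (S A : TTy Label) → eraseTy S ≡ bar X → eraseTy A ≡ bar X → (b : ℕ) →
  Annotation (ε ▸ (x , S)) A (cps (ax {x} {X})) b
annotate-ax {x} S A eS eA b =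
  annotation (ηL (suc x) (var x) sh) (ηL-der (suc x) sh ax)
             (ηL-annotates (suc x) sh ax ax eA (≈-ax eS)) 0
             (λ l → ≤-trans (ηL-occ (suc x) (var x) sh l) (≤-reflexive (sym (+-identityʳ _))))
  where sh = sameShape S A (trans eS (sym eA))

annotate-1i : ∀ q a b → Annotation ε (¬⟨ q ⟩ (¬⟨ a ⟩ 𝟙)) (cps 1i) b
annotate-1i q a b =
  annotation (lam q 0 (app (var 0) a ∗)) (→i (→e ax 1i)) (≈-refl _) 0
             (λ l → ≤-reflexive (pad (δ q l)))
  where
    pad : ∀ n → n + 0 ≡ n + (0 + 0) + 0 + 0
    pad = solve-∀

-- (weak)  a new hypothesis only adds available labels
annotate-weak : ∀ {Γ t X x Y} {d : Γ ⊢ t ∶ X} {Γ' A S b} → eraseTy S ≡ bar Y →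
  Annotation Γ' A (cps d) b → Annotation (Γ' ▸ (x , S)) A (cps (weak {x = x} {X = Y} d)) b
annotate-weak {Γ' = Γ'} {A} {S} {b} eS (annotation t' d' h n c) =
  annotation t' (weak d') (≈-weak eS h) n
             (λ l → ≤-trans (c l) (+-monoˡ-≤ (blockOcc b n l)
                                    (+-monoˡ-≤ (posOcc A l) (m≤m+n (negOccCx Γ' l) (negOcc S l)))))

annotate-exch : ∀ {Γ Δ x X y Y t Z} {d : ((Γ ▸ (y , Y) ▸ (x , X)) ⧺ Δ) ⊢ t ∶ Z} {Γ₁ Δ₁ Sx Sy A b} →
  eraseCx Γ₁ ≡ barC Γ → eraseCx Δ₁ ≡ barC Δ → eraseTy Sx ≡ bar X → eraseTy Sy ≡ bar Y →
  Annotation ((Γ₁ ▸ (y , Sy) ▸ (x , Sx)) ⧺ Δ₁) A (cps d) b →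
  Annotation ((Γ₁ ▸ (x , Sx) ▸ (y , Sy)) ⧺ Δ₁) A (cps (exch {Γ} {Δ} {x} {X} {y} {Y} d)) b
annotate-exch {x = x} {y = y} {Γ₁ = Γ₁} {Δ₁} {Sx} {Sy} {A} {b} eΓ eΔ eSx eSy (annotation t' d' h n c) =
  annotation t' (exch {Γ = Γ₁} {Δ = Δ₁} d')
             (≈-trL _ (≈-trR _ (≈-exch eΓ eΔ eSx eSy (≈-trL _ (≈-trR _ h))))) n
             (λ l → ≤-trans (c l) (≤-reflexive (cong (_+ blockOcc b n l)
                                     (available-exch Γ₁ Δ₁ x y Sx Sy A l))))

annotate-→i : ∀ {Γ x X t Y} {d : (Γ ▸ (x , X)) ⊢ t ∶ Y} {Γ' SX BY q b} →
  eraseTy SX ≡ bar X → eraseTy BY ≡ cont Y →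
  Annotation (Γ' ▸ (x , SX)) (¬⟨ b ⟩ BY) (cps d) (suc b) →
  Annotation Γ' (¬⟨ q ⟩ (SX ⊗ BY)) (cps (→i d)) b
annotate-→i {Γ} {x} {X} {Γ' = Γ'} {SX} {BY} {q} {b} eSX eBY (annotation t₁ d₁ h n c) =
  annotation (lam q z (letp (var z) x (suc z) (app t₁ b (var (suc z)))))
             (→i (×e ax (→e d₁ ax)))
             (≈-→i (≈-trL _ (≈-×e (≈-ax (cong₂ _⊗_ eSX eBY)) (≈-trL _ (≈-→e h (≈-ax eBY))))))
             (suc n) bound
  where
    z = fresh (Γ ▸ (x , X))
    regroup : ∀ q o g s i y r → q + (o + 0) ≤ q + (((g + s) + (i + y + 0) + r) + 0) →
              q + (o + 0) ≤ g + (q + (s + y) + 0) + (i + r)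
    regroup q o g s i y r h = ≤-trans h (≤-reflexive (e q g s i y r))
      where
        e : ∀ q g s i y r → q + (((g + s) + (i + y + 0) + r) + 0) ≡ g + (q + (s + y) + 0) + (i + r)
        e = solve-∀
    bound : ∀ l → δ q l + occ (absLabels t₁ ++ []) l ≤ available Γ' (¬⟨ q ⟩ (SX ⊗ BY)) l + blockOcc b (suc n) l
    bound l =
      ≤-trans (≤-reflexive (cong (δ q l +_) (occ-++ (absLabels t₁) [] l)))
        (regroup (δ q l) (occ (absLabels t₁) l) (negOccCx Γ' l) (negOcc SX l) (δ b l) (negOcc BY l)
                 (blockOcc (suc b) n l) (+-monoʳ-≤ (δ q l) (+-monoˡ-≤ 0 (c l))))

annotate-→e : ∀ {Γ Δ s t X Y} {ds : Γ ⊢ s ∶ (X ⇒ Y)} {dt : Δ ⊢ t ∶ X} {Γs Γt F B q b nF} →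
  eraseTy B ≡ cont Y → (∀ l → posOcc F l + negOcc F l ≤ blockOcc (suc b) nF l) →
  (ihs : Annotation Γs (¬⟨ b ⟩ (F ⊗ B)) (cps ds) (suc b + nF)) →
  Annotation Γt F (cps dt) (suc b + nF + Annotation.used ihs) →
  Annotation (Γs ⧺ Γt) (¬⟨ q ⟩ B) (cps (→e ds dt)) b
annotate-→e {Γ} {Δ} {Γs = Γs} {Γt} {F} {B} {q} {b} {nF} eB cF
            (annotation ts ds' hs ns cs) (annotation tu dt' ht nt ct) =
  annotation (lam q k (app ts b (pair tu (var k)))) (→i (→e ds' (×i dt' ax)))
             (≈-trR _ (≈-→i (≈-trL _ (≈-→e hs (≈-trL _ (≈-×i ht (≈-ax eB)))))))
             (suc (nF + (ns + nt))) bound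
  where
    k = fresh (Γ ⧺ Δ)
    regroup : ∀ q gs gt i nf pf nb rf rs rt → pf + nf ≤ rf →
              q + ((gs + (i + (nf + nb) + 0) + rs) + ((gt + pf + rt) + 0))
              ≤ (gs + gt) + (q + nb + 0) + (i + (rf + (rs + rt)))
    regroup q gs gt i nf pf nb rf rs rt h =
      ≤-trans (≤-reflexive (e₁ q gs gt i nf pf nb rs rt))
        (≤-trans (+-monoʳ-≤ _ h) (≤-reflexive (e₂ q gs gt i nb rs rt rf)))
      where
        e₁ : ∀ q gs gt i nf pf nb rs rt →
             q + ((gs + (i + (nf + nb) + 0) + rs) + ((gt + pf + rt) + 0))
             ≡ (q + gs + gt + i + nb + rs + rt) + (pf + nf)
        e₁ = solve-∀
        e₂ : ∀ q gs gt i nb rs rt rf →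
             (q + gs + gt + i + nb + rs + rt) + rf ≡ (gs + gt) + (q + nb + 0) + (i + (rf + (rs + rt)))
        e₂ = solve-∀
    bound : ∀ l → occ (absLabels (lam q k (app ts b (pair tu (var k))))) l ≤
                  available (Γs ⧺ Γt) (¬⟨ q ⟩ B) l + blockOcc b (suc (nF + (ns + nt))) l
    bound l rewrite occ-++ (absLabels ts) (absLabels tu ++ []) l | occ-++ (absLabels tu) [] l
                  | negOccCx-⧺ Γs Γt l | blockOcc-split (suc b) nF (ns + nt) l
                  | blockOcc-split (suc b + nF) ns nt l =
      ≤-trans (+-monoʳ-≤ (δ q l) (+-mono-≤ (cs l) (+-monoˡ-≤ 0 (ct l))))
        (regroup (δ q l) (negOccCx Γs l) (negOccCx Γt l) (δ b l) (negOcc F l) (posOcc F l) (negOcc B l)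
                 (blockOcc (suc b) nF l) (blockOcc (suc b + nF) ns l) (blockOcc (suc b + nF + ns) nt l)
                 (cF l))

annotate : ∀ {Γ t X} (d : Γ ⊢ t ∶ X) (Γ' : LCx) (A : TTy Label) →
  eraseCx Γ' ≡ barC Γ → eraseTy A ≡ bar X → (b : ℕ) → Annotation Γ' A (cps d) b
annotate ax Γ' A eΓ eA b with invert-▸ Γ' eΓ
... | Γ₁ , S , refl , e₁ , eS with invert-ε Γ₁ e₁
... | refl = annotate-ax S A eS eA b
annotate 1i Γ' A eΓ eA b with invert-ε Γ' eΓ | invert-¬ A eA
... | refl | A₁ , q , refl , e₁ with invert-¬ A₁ e₁
... | A₂ , a , refl , e₂ with invert-𝟙 A₂ e₂
... | refl = annotate-1i q a b
annotate (weak d) Γ' A eΓ eA b with invert-▸ Γ' eΓ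
... | Γ₁ , S , refl , e₁ , eS = annotate-weak {d = d} eS (annotate d Γ₁ A e₁ eA b)
annotate (exch {Γ} {Δ} {x} {X} {y} {Y} d) Γ' A eΓ eA b
  with invert-⧺ Γ' (barC (Γ ▸ (x , X) ▸ (y , Y))) (barC Δ)
                 (trans eΓ (mapCx-⧺ bar (Γ ▸ (x , X) ▸ (y , Y)) Δ))
... | Γ₂ , Δ₁ , refl , eΓ₂ , eΔ with invert-▸ Γ₂ eΓ₂
... | Γ₃ , Sy , refl , eΓ₃ , eSy with invert-▸ Γ₃ eΓ₃
... | Γ₁ , Sx , refl , eΓ₁ , eSx =
  annotate-exch {d = d} eΓ₁ eΔ eSx eSy
    (annotate d ((Γ₁ ▸ (y , Sy) ▸ (x , Sx)) ⧺ Δ₁) A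
      (trans (mapCx-⧺ eraseTy (Γ₁ ▸ (y , Sy) ▸ (x , Sx)) Δ₁)
        (trans (cong₂ (λ G D → (G ▸ (y , _) ▸ (x , _)) ⧺ D) eΓ₁ eΔ)
          (trans (cong₂ (λ V W → (barC Γ ▸ (y , V) ▸ (x , W)) ⧺ barC Δ) eSy eSx)
            (sym (mapCx-⧺ bar (Γ ▸ (y , Y) ▸ (x , X)) Δ))))) eA b)
annotate (→i {x = x} d) Γ' A eΓ eA b with invert-¬ A eA
... | C , q , refl , eC with invert-⊗ C eC
... | SX , BY , refl , eSX , eBY =
  annotate-→i {d = d} eSX eBY
    (annotate d (Γ' ▸ (x , SX)) (¬⟨ b ⟩ BY) (cong₂ (λ G V → G ▸ (x , V)) eΓ eSX)
              (cong ¬_ eBY) (suc b))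
annotate (→e {Γ} {Δ} {X = X} ds dt) Γ' A eΓ eA b
  with invert-⧺ Γ' (barC Γ) (barC Δ) (trans eΓ (mapCx-⧺ bar Γ Δ)) | invert-¬ A eA
... | Γs , Γt , refl , eΓs , eΓt | B , q , refl , eB with freshLabelling (bar X) (suc b)
... | F , nF , eF , cF = annotate-→e {ds = ds} {dt = dt} eB cF ihs (annotate dt Γt F eΓt eF _)
  where
    ihs = annotate ds Γs (¬⟨ b ⟩ (F ⊗ B)) eΓs (cong ¬_ (cong₂ _⊗_ eF eB)) (suc b + nF)

mutual
  barL-erases : ∀ X xm xp → eraseTy (proj₂ (barL X xm xp)) ≡ cont X
  barL-erases 𝟙       (q ∷ []) (a ∷ []) = refl
  barL-erases (X ⇒ Y) xm       xp       = cong₂ _⊗_ (barTy-erases X _ _) (barL-erases Y _ _)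

  barTy-erases : ∀ X xm xp → eraseTy (barTy X xm xp) ≡ bar X
  barTy-erases X xm xp = cong ¬_ (barL-erases X xm xp)

barCx-erases : ∀ Γ γm γp → eraseCx (barCx Γ γm γp) ≡ barC Γ
barCx-erases ε             γm γp = refl
barCx-erases (Γ ▸ (x , X)) γm γp =
  cong₂ (λ G V → G ▸ (x , V)) (barCx-erases Γ _ _) (barTy-erases X _ _)

barL-occ : ∀ X xm xp l →
  δ (proj₁ (barL X xm xp)) l + negOcc (proj₂ (barL X xm xp)) l + posOcc (proj₂ (barL X xm xp)) l
    ≡ occ (toList xm) l + occ (toList xp) l
barL-occ 𝟙 (q ∷ []) (a ∷ []) l = regroup (δ q l) (δ a l)
  where
    regroup : ∀ a b → a + 0 + (b + 0 + 0) ≡ (a + 0) + (b + 0)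
    regroup = solve-∀
barL-occ (X ⇒ Y) xm xp l =
  trans (regroup₁ (δ qY l) (negOcc Y' l) (posOcc Y' l) (δ qX l) (negOcc X' l) (posOcc X' l))
  (trans (cong₂ _+_ (barL-occ Y ym yp l) (barL-occ X xp' xm' l))
  (trans (regroup₂ (occ (toList ym) l) (occ (toList yp) l) (occ (toList xp') l) (occ (toList xm') l))
    (sym (cong₂ _+_ (occ-take-drop (neg Y) xm l) (occ-take-drop (pos Y) xp l)))))
  where
    ym  = take (neg Y) xm
    yp  = take (pos Y) xp
    xp' = drop (pos Y) xp
    xm' = drop (neg Y) xm
    qY  = proj₁ (barL Y ym yp)
    Y'  = proj₂ (barL Y ym yp)
    qX  = proj₁ (barL X xp' xm')
    X'  = proj₂ (barL X xp' xm')
    regroup₁ : ∀ q nY pY qx nX pX →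
               q + ((pX + 0) + nY) + ((qx + nX + 0) + pY) ≡ (q + nY + pY) + (qx + nX + pX)
    regroup₁ = solve-∀
    regroup₂ : ∀ a b c d → (a + b) + (c + d) ≡ (a + d) + (b + c)
    regroup₂ = solve-∀

barTy-occ : ∀ X xm xp l →
  posOcc (barTy X xm xp) l + negOcc (barTy X xm xp) l ≡ occ (toList xm) l + occ (toList xp) l
barTy-occ X xm xp l =
  trans (regroup (δ (proj₁ (barL X xm xp)) l) (negOcc (proj₂ (barL X xm xp)) l)
                 (posOcc (proj₂ (barL X xm xp)) l))
        (barL-occ X xm xp l)
  where
    regroup : ∀ q n p → (q + n + 0) + (p + 0) ≡ q + n + p
    regroup = solve-∀

barCx-occ : ∀ Γ γm γp l →
  negOccCx (barCx Γ γm γp) l + posOccCx (barCx Γ γm γp) l ≡ occ (toList γm) l + occ (toList γp) l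
barCx-occ ε             [] [] l = refl
barCx-occ (Γ ▸ (x , X)) γm γp l =
  trans (regroup₁ (negOccCx G l) (negOcc T l) (posOccCx G l) (posOcc T l))
  (trans (cong₂ _+_ (barCx-occ Γ (drop (neg X) γm) (drop (pos X) γp) l)
                    (barTy-occ X (take (neg X) γm) (take (pos X) γp) l))
  (trans (regroup₂ (occ (toList (drop (neg X) γm)) l) (occ (toList (drop (pos X) γp)) l)
                   (occ (toList (take (neg X) γm)) l) (occ (toList (take (pos X) γp)) l))
    (sym (cong₂ _+_ (occ-take-drop (neg X) γm l) (occ-take-drop (pos X) γp l)))))
  where
    G = barCx Γ (drop (neg X) γm) (drop (pos X) γp)
    T = barTy X (take (neg X) γm) (take (pos X) γp)
    regroup₁ : ∀ a b c d → (a + b) + (c + d) ≡ (a + c) + (d + b)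
    regroup₁ = solve-∀
    regroup₂ : ∀ a b c d → (a + b) + (c + d) ≡ (c + a) + (d + b)
    regroup₂ = solve-∀

module Interface (Γ : Cx Ty) (X : Ty) where
  N : ℕ
  N = negC Γ + posC Γ + neg X + pos X

  γm : Vec Label (negC Γ)
  γm = block 0 (negC Γ)
  γp : Vec Label (posC Γ)
  γp = block (negC Γ) (posC Γ)
  xm : Vec Label (neg X)
  xm = block (negC Γ + posC Γ) (neg X)
  xp : Vec Label (pos X)
  xp = block (negC Γ + posC Γ + neg X) (pos X)

  interface-occ : ∀ l →
    occ (toList γm ++ toList γp ++ toList xm ++ toList xp) l ≡ blockOcc 0 N l
  interface-occ l
    rewrite occ-++₄ (toList γm) (toList γp) (toList xm) (toList xp) l
          | occ-block 0 (negC Γ) l | occ-block (negC Γ) (posC Γ) l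
          | occ-block (negC Γ + posC Γ) (neg X) l | occ-block (negC Γ + posC Γ + neg X) (pos X) l
          | blockOcc-split 0 (negC Γ + posC Γ + neg X) (pos X) l
          | blockOcc-split 0 (negC Γ + posC Γ) (neg X) l
          | blockOcc-split 0 (negC Γ) (posC Γ) l =
    sym (+-assoc (blockOcc 0 (negC Γ) l + blockOcc (negC Γ) (posC Γ) l) _ _)

  available-interface : ∀ l → available (barCx Γ γm γp) (barTy X xm xp) l ≤ blockOcc 0 N l
  available-interface l =
    ≤-trans (+-mono-≤ (m≤m+n (negOccCx (barCx Γ γm γp) l) (posOccCx (barCx Γ γm γp) l))
                      (m≤m+n (posOcc (barTy X xm xp) l) (negOcc (barTy X xm xp) l)))
      (≤-reflexive (trans (cong₂ _+_ (barCx-occ Γ γm γp l) (barTy-occ X xm xp l))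
                   (trans (sym (occ-++₄ (toList γm) (toList γp) (toList xm) (toList xp) l))
                          (interface-occ l))))

lemma6p2 : ∀ {Γ t X} (d : Γ ⊢ t ∶ X) →
    Σ (Vec Label (negC Γ)) λ γm → Σ (Vec Label (posC Γ)) λ γp →
    Σ (Vec Label (neg X)) λ xm → Σ (Vec Label (pos X)) λ xp →
    Σ (TTm Label) λ t' →
    Σ (TDer (barCx Γ γm γp) t' (barTy X xm xp)) λ d' →
    d' Annotates (cps d) × Unique (absLabels t') × WellLabelled γm γp xm xp
lemma6p2 {Γ} {X = X} d =
  γm , γp , xm , xp , term , der , annotates ,
  occ≤1⇒Unique (absLabels term) abstractions-distinct ,
  occ≤1⇒Unique _ (λ l → ≤-trans (≤-reflexive (interface-occ l)) (blockOcc≤1 0 N l))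
  where
    open Interface Γ X
    open Annotation (annotate d (barCx Γ γm γp) (barTy X xm xp)
                              (barCx-erases Γ γm γp) (barTy-erases X xm xp) N)
    -- abstraction labels are interface labels or fresh labels from N on
    abstractions-distinct : ∀ l → occ (absLabels term) l ≤ 1
    abstractions-distinct l =
      ≤-trans (bound l)
        (≤-trans (+-monoˡ-≤ (blockOcc N used l) (available-interface l))
          (≤-trans (≤-reflexive (sym (blockOcc-split 0 N used l))) (blockOcc≤1 0 (N + used) l)))
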